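{- Let $s\geqslant 2$ and $n\geqslant 1$ be integers. Let $H^{(s-1)}_n=\{1_1,\ldots,1_{s-1},2_1,\ldots,2_{s-1},\ldots,(n-1)_1,\ldots,(n-1)_{s-1},n\}$, a set of $(s-1)(n-1)+1$ distinct elements, where $i_j$ denotes the integer $i$ carrying color $j\in\{1,\ldots,s-1\}$ and $n$ is uncolored. Let $\mathcal{C}^{(s-1)}_n$ be the collection of subsets $C\subset H^{(s-1)}_n$ such that $n\in C$ and $\min C\geqslant |C|$. Then $|\mathcal{C}^{(s-1)}_n| = K^{(s)}_{(s-1)(n-1)+1}$.
   Context: The minimum $\min C$ is taken with respect to the underlying integer values (the value of $i_j$ is $i$). For $u\geqslant 2$, the sequence $(K^{(u)}_m)_{m\geqslant 1}$ is defined by $K^{(u)}_1=\cdots=K^{(u)}_u=1$ and $K^{(u)}_m=K^{(u)}_{m-1}+K^{(u)}_{m-u}$ for $m\geqslant u+1$. -}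

module Defs where

open import Data.Nat using (ℕ; zero; suc; _+_; _*_; _∸_; _≤_; _⊓_; _≤?_)
open import Data.Bool using (Bool; true; false; if_then_else_)
open import Data.Vec using (Vec; []; _∷_)
open import Data.List using (List; []; _∷_; map; concatMap; length; filter)
open import Data.Maybe using (Maybe; just; nothing)
open import Data.Product using (_×_; _,_)
open import Relation.Binary.PropositionalEquality using (_≡_)
open import Relation.Nullary using (Dec; yes; no)
open import Relation.Nullary.Decidable using (_×-dec_)
open import Relation.Unary using (Decidable)
open import Data.Bool.Properties using () renaming (_≟_ to _≟ᵇ_)

-- The sequence K^(u)_m (meaningful for m ≥ 1):
--   K_1 = … = K_u = 1,  K_m = K_{m-1} + K_{m-u}  (m ≥ u+1).
-- Implemented with a fuel argument (fuel = m suffices since both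
-- recursive indices are strictly smaller and ≥ 1 when u ≥ 2).

Kfuel : ℕ → ℕ → ℕ → ℕ
Kfuel u zero    m = 1
Kfuel u (suc f) m with m ≤? u
... | yes _ = 1
... | no  _ = Kfuel u f (m ∸ 1) + Kfuel u f (m ∸ u)

K : ℕ → ℕ → ℕ
K u m = Kfuel u m m

-- A subset C ⊆ H^(s-1)_n is given by its characteristic data:
--   grid : row r (0-indexed, r < n-1), column j (j < s-1) says whether
--          the element (r+1)_(j+1) belongs to C;
--   top  : whether the uncoloured element n belongs to C.

record SubsetH (s n : ℕ) : Set where
  constructor mkSub
  field
    grid : Vec (Vec Bool (s ∸ 1)) (n ∸ 1)
    top  : Bool
open SubsetH public

allVecs : (m : ℕ) → List (Vec Bool m)
allVecs zero    = [] ∷ []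
allVecs (suc m) = concatMap (λ v → (true Data.Vec.∷ v) ∷ (false Data.Vec.∷ v) ∷ []) (allVecs m)

allGrids : (k r : ℕ) → List (Vec (Vec Bool k) r)
allGrids k zero    = [] ∷ []
allGrids k (suc r) = concatMap (λ row → map (row ∷_) (allGrids k r)) (allVecs k)

allSubsetsH : (s n : ℕ) → List (SubsetH s n)
allSubsetsH s n =
  concatMap (λ g → mkSub g true ∷ mkSub g false ∷ []) (allGrids (s ∸ 1) (n ∸ 1))

countT : {m : ℕ} → Vec Bool m → ℕ
countT []           = 0
countT (true  ∷ v)  = suc (countT v)
countT (false ∷ v)  = countT v

countGrid : {k r : ℕ} → Vec (Vec Bool k) r → ℕ
countGrid []       = 0
countGrid (v ∷ g)  = countT v + countGrid g

card : {s n : ℕ} → SubsetH s n → ℕ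
card C = countGrid (grid C) + (if top C then 1 else 0)

anyT : {m : ℕ} → Vec Bool m → Bool
anyT []          = false
anyT (true ∷ v)  = true
anyT (false ∷ v) = anyT v

minMaybe : Maybe ℕ → Maybe ℕ → Maybe ℕ
minMaybe (just a) (just b) = just (a ⊓ b)
minMaybe (just a) nothing  = just a
minMaybe nothing  y        = y

-- minimum underlying integer value among present grid elements,
-- where row r of the grid carries the integer value (start + r)
minGrid : {k r : ℕ} → ℕ → Vec (Vec Bool k) r → Maybe ℕ
minGrid start []      = nothing
minGrid start (v ∷ g) =
  minMaybe (if anyT v then just start else nothing) (minGrid (suc start) g)

-- min C w.r.t. underlying integer values (nothing iff C = ∅)
minH : {s n : ℕ} → SubsetH s n → Maybe ℕ
minH {s} {n} C = minMaybe (minGrid 1 (grid C)) (if top C then just n else nothing)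

MinCond : Maybe ℕ → ℕ → Set
MinCond (just m) c = c ≤ m
MinCond nothing  c = c ≡ 0 -- unused: C ∋ n is nonempty

minCond? : (x : Maybe ℕ) (c : ℕ) → Dec (MinCond x c)
minCond? (just m) c = c ≤? m
minCond? nothing  c = c Data.Nat.≟ 0

InCollection : {s n : ℕ} → SubsetH s n → Set
InCollection C = (top C ≡ true) × MinCond (minH C) (card C)

inCollection? : {s n : ℕ} → Decidable (InCollection {s} {n})
inCollection? C = (top C ≟ᵇ true) ×-dec minCond? (minH C) (card C)

collectionSize : (s n : ℕ) → ℕ
collectionSize s n = length (filter inCollection? (allSubsetsH s n))

-- A set C in the collection consists of n and k further elements, all of value at least
-- |C| = k + 1; so it is a choice of k elements among the (n − 1 − k)(s − 1) coloured elements
-- of values k + 1, …, n − 1, and the collection has  ∑ₖ binom((n − 1 − k)(s − 1), k)  members.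
-- With c = s − 1 the diagonal sums  F(M) = ∑ₖ binom(M − k c, k)  satisfy F(M) = 1 for M ≤ c
-- and, by Pascal's rule, F(M + 1) = F(M) + F(M − c) for M ≥ c. This is the recurrence of
-- K^(c+1) shifted by one, so the count F(c (n − 1)) equals K^(s)_(c (n − 1) + 1).
module Submission where

open import Defs
open import Data.Bool using (Bool; true; false; if_then_else_; not; _∧_; T)
open import Data.Empty using (⊥-elim)
open import Data.List using (List; []; _∷_; _++_; _∷ʳ_; map; concatMap; filter; length; applyUpTo)
open import Data.List.Properties using (map-++; map-∘; map-cong; applyUpTo-∷ʳ)
open import Data.Maybe using (Maybe; just; nothing)
open import Data.Nat using (ℕ; zero; suc; _+_; _*_; _∸_; _≤_; _<_; _≤?_; _≡ᵇ_; z≤n; s≤s)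
open import Data.Nat.Combinatorics using (_C_; nCk+nC[k+1]≡[n+1]C[k+1]; k>n⇒nCk≡0)
open import Data.Nat.Induction using (<-rec)
open import Data.Nat.ListAction using (sum)
open import Data.Nat.ListAction.Properties using (sum-++)
open import Data.Nat.Properties
open import Algebra.Properties.CommutativeSemigroup +-commutativeSemigroup using (interchange)
open import Data.Product using (_,_)
open import Data.Unit using (⊤; tt)
open import Data.Vec using (Vec; []; _∷_)
open import Function using (id; _∘_)
open import Function.Bundles using (_⇔_; mk⇔; Equivalence)
open import Level using (0ℓ)
open import Relation.Binary.PropositionalEquality
open import Relation.Nullary using (does; proof; yes; no)
open import Relation.Nullary.Reflects using (det; fromEquivalence)
open import Relation.Unary using (Pred; Decidable)

open Equivalence using (to; from)

private
  variable
    A B : Set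

𝟙 : Bool → ℕ
𝟙 b = if b then 1 else 0

if-0-else-0 : ∀ b → (if b then 0 else 0) ≡ 0
if-0-else-0 true  = refl
if-0-else-0 false = refl

∑ : List A → (A → ℕ) → ℕ
∑ xs f = sum (map f xs)

∑-++ : (xs ys : List A) (f : A → ℕ) → ∑ (xs ++ ys) f ≡ ∑ xs f + ∑ ys f
∑-++ xs ys f = trans (cong sum (map-++ f xs ys)) (sum-++ (map f xs) (map f ys))

∑-concatMap : (h : A → List B) (xs : List A) (f : B → ℕ) →
              ∑ (concatMap h xs) f ≡ ∑ xs (λ x → ∑ (h x) f)
∑-concatMap h []       f = refl
∑-concatMap h (x ∷ xs) f =
  trans (∑-++ (h x) (concatMap h xs) f) (cong (∑ (h x) f +_) (∑-concatMap h xs f))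

∑-map : (h : A → B) (xs : List A) (f : B → ℕ) → ∑ (map h xs) f ≡ ∑ xs (f ∘ h)
∑-map h xs f = cong sum (sym (map-∘ xs))

∑-cong : (xs : List A) {f g : A → ℕ} → (∀ x → f x ≡ g x) → ∑ xs f ≡ ∑ xs g
∑-cong xs f≗g = cong sum (map-cong f≗g xs)

∑-+ : (xs : List A) (f g : A → ℕ) → ∑ xs (λ x → f x + g x) ≡ ∑ xs f + ∑ xs g
∑-+ []       f g = refl
∑-+ (x ∷ xs) f g =
  trans (cong (f x + g x +_) (∑-+ xs f g)) (interchange (f x) (g x) (∑ xs f) (∑ xs g))

∑-zero : (xs : List A) {f : A → ℕ} → (∀ x → f x ≡ 0) → ∑ xs f ≡ 0
∑-zero []       f≗0 = refl
∑-zero (x ∷ xs) f≗0 = cong₂ _+_ (f≗0 x) (∑-zero xs f≗0)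

length-filter : {P : Pred A 0ℓ} (P? : Decidable P) (xs : List A) →
                length (filter P? xs) ≡ ∑ xs (𝟙 ∘ does ∘ P?)
length-filter P? []       = refl
length-filter P? (x ∷ xs) with does (P? x)
... | true  = cong suc (length-filter P? xs)
... | false = length-filter P? xs

∑≤ : ℕ → (ℕ → ℕ) → ℕ
∑≤ B f = sum (applyUpTo f (suc B))

∑≤-cong : ∀ B {f g : ℕ → ℕ} → (∀ k → f k ≡ g k) → ∑≤ B f ≡ ∑≤ B g
∑≤-cong zero    f≗g = cong (_+ 0) (f≗g 0)
∑≤-cong (suc B) f≗g = cong₂ _+_ (f≗g 0) (∑≤-cong B (f≗g ∘ suc))

∑≤-+ : ∀ B (f g : ℕ → ℕ) → ∑≤ B (λ k → f k + g k) ≡ ∑≤ B f + ∑≤ B g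
∑≤-+ zero    f g =
  trans (+-identityʳ _) (sym (cong₂ _+_ (+-identityʳ (f 0)) (+-identityʳ (g 0))))
∑≤-+ (suc B) f g =
  trans (cong (f 0 + g 0 +_) (∑≤-+ B (f ∘ suc) (g ∘ suc)))
        (interchange (f 0) (g 0) (∑≤ B (f ∘ suc)) (∑≤ B (g ∘ suc)))

∑≤-zero : ∀ B {f : ℕ → ℕ} → (∀ k → f k ≡ 0) → ∑≤ B f ≡ 0
∑≤-zero zero    f≗0 = cong (_+ 0) (f≗0 0)
∑≤-zero (suc B) f≗0 = cong₂ _+_ (f≗0 0) (∑≤-zero B (f≗0 ∘ suc))

∑≤-suc : ∀ B (f : ℕ → ℕ) → ∑≤ (suc B) f ≡ ∑≤ B f + f (suc B)
∑≤-suc B f = begin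
  sum (applyUpTo f (suc (suc B)))                 ≡⟨ cong sum (applyUpTo-∷ʳ f (suc B)) ⟨
  sum (applyUpTo f (suc B) ∷ʳ f (suc B))           ≡⟨ sum-++ (applyUpTo f (suc B)) _ ⟩
  ∑≤ B f + (f (suc B) + 0)                        ≡⟨ cong (∑≤ B f +_) (+-identityʳ _) ⟩
  ∑≤ B f + f (suc B)                              ∎
  where open ≡-Reasoning

∑≤-select : ∀ B j (b : ℕ → Bool) → j ≤ B →
            ∑≤ B (λ k → if b k then 𝟙 (j ≡ᵇ k) else 0) ≡ 𝟙 (b j)
∑≤-select zero    zero    b z≤n       = +-identityʳ (𝟙 (b 0))
∑≤-select (suc B) zero    b z≤n       =
  trans (cong (𝟙 (b 0) +_) (∑≤-zero B (if-0-else-0 ∘ b ∘ suc))) (+-identityʳ (𝟙 (b 0)))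
∑≤-select (suc B) (suc j) b (s≤s j≤B) =
  cong₂ _+_ (if-0-else-0 (b 0)) (∑≤-select B j (b ∘ suc) j≤B)

∑-∑≤ : (xs : List A) (B : ℕ) (F : ℕ → A → ℕ) →
       ∑ xs (λ x → ∑≤ B (λ k → F k x)) ≡ ∑≤ B (λ k → ∑ xs (F k))
∑-∑≤ xs zero    F =
  trans (∑-cong xs (λ x → +-identityʳ (F 0 x))) (sym (+-identityʳ (∑ xs (F 0))))
∑-∑≤ xs (suc B) F =
  trans (∑-+ xs (F 0) _) (cong (∑ xs (F 0) +_) (∑-∑≤ xs B (F ∘ suc)))

-- The sequence K and diagonal sums of binomial coefficients

Kfuel-zero : ∀ {u} f → Kfuel u f 0 ≡ 1
Kfuel-zero     zero    = refl
Kfuel-zero {u} (suc f) with 0 ≤? u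
... | yes _   = refl
... | no  0≰u = ⊥-elim (0≰u z≤n)

K-≤ : ∀ {u m} → m ≤ u → K u m ≡ 1
K-≤ {u} {zero}  _   = refl
K-≤ {u} {suc m} m≤u with suc m ≤? u
... | yes _   = refl
... | no  m≰u = ⊥-elim (m≰u m≤u)

module _ {u : ℕ} (1≤u : 1 ≤ u) where

  Kfuel-irrelevant : ∀ f f′ {m} → m ≤ f → m ≤ f′ → Kfuel u f m ≡ Kfuel u f′ m
  Kfuel-irrelevant zero    f′      z≤n _   = sym (Kfuel-zero {u} f′)
  Kfuel-irrelevant (suc f) zero    _   z≤n = Kfuel-zero {u} (suc f)
  Kfuel-irrelevant (suc f) (suc f′) {m} m≤1+f m≤1+f′ with m ≤? u
  ... | yes _ = refl
  ... | no  _ = cong₂ _+_ (Kfuel-irrelevant f f′ (∸-monoˡ-≤ 1 m≤1+f) (∸-monoˡ-≤ 1 m≤1+f′))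
                          (Kfuel-irrelevant f f′ (≤-trans m∸u≤m∸1 (∸-monoˡ-≤ 1 m≤1+f))
                                                 (≤-trans m∸u≤m∸1 (∸-monoˡ-≤ 1 m≤1+f′)))
    where
    m∸u≤m∸1 : m ∸ u ≤ m ∸ 1
    m∸u≤m∸1 = ∸-monoʳ-≤ m 1≤u

  K-suc : ∀ {m} → u ≤ m → K u (suc m) ≡ K u m + K u (suc m ∸ u)
  K-suc {m} u≤m with suc m ≤? u
  ... | yes m<u = ⊥-elim (<-irrefl refl (≤-trans m<u u≤m))
  ... | no  _   = cong (K u m +_) (Kfuel-irrelevant m (suc m ∸ u) (∸-monoʳ-≤ (suc m) 1≤u) ≤-refl)

diagonalSum : ℕ → ℕ → ℕ → ℕ
diagonalSum c M B = ∑≤ B (λ k → (M ∸ k * c) C k)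

-- The truncated subtraction is harmless: when k * c > o both sides vanish, since then k > 0.
C-pascal-∸ : ∀ c o k → (suc o ∸ k * c) C suc k ≡ (o ∸ k * c) C k + (o ∸ k * c) C suc k
C-pascal-∸ c o k with k * c ≤? o
... | yes kc≤o = trans (cong (_C suc k) (+-∸-assoc 1 kc≤o)) (sym (nCk+nC[k+1]≡[n+1]C[k+1] (o ∸ k * c) k))
... | no  kc≰o with k
...   | zero  = ⊥-elim (kc≰o z≤n)
...   | suc k′ rewrite m≤n⇒m∸n≡0 (≰⇒> kc≰o) | m≤n⇒m∸n≡0 (<⇒≤ (≰⇒> kc≰o)) = refl

diagonalSum-≤ : ∀ {c M} B → M ≤ c → diagonalSum c M B ≡ 1
diagonalSum-≤ zero    M≤c = refl
diagonalSum-≤ {c} {M} (suc B) M≤c = cong suc (∑≤-zero B vanish)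
  where
  vanish : ∀ k → (M ∸ (c + k * c)) C suc k ≡ 0
  vanish k rewrite m≤n⇒m∸n≡0 (≤-trans M≤c (m≤m+n c (k * c))) = refl

diagonalSum⁺ : ℕ → ℕ → ℕ → ℕ
diagonalSum⁺ c M B = ∑≤ B (λ k → (M ∸ k * c) C suc k)

diagonalSum-suc : ∀ c M B → diagonalSum c M (suc B) ≡ suc (diagonalSum⁺ c (M ∸ c) B)
diagonalSum-suc c M B = cong suc (∑≤-cong B (λ k → cong (_C suc k) (sym (∸-+-assoc M c (k * c)))))

diagonalSum⁺-suc : ∀ c o B → diagonalSum⁺ c (suc o) B ≡ diagonalSum c o B + diagonalSum⁺ c o B
diagonalSum⁺-suc c o B = trans (∑≤-cong B (C-pascal-∸ c o)) (∑≤-+ B (λ k → (o ∸ k * c) C k) (λ k → (o ∸ k * c) C suc k))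

diagonalSum-stable : ∀ {c o} B → o ≤ B → diagonalSum c o (suc B) ≡ diagonalSum c o B
diagonalSum-stable {c} {o} B o≤B = begin
  diagonalSum c o (suc B)                                       ≡⟨ ∑≤-suc B (λ k → (o ∸ k * c) C k) ⟩
  diagonalSum c o B + (o ∸ suc B * c) C suc B                   ≡⟨ cong (diagonalSum c o B +_) (k>n⇒nCk≡0 (s≤s (≤-trans (m∸n≤m o (suc B * c)) o≤B))) ⟩
  diagonalSum c o B + 0                                         ≡⟨ +-identityʳ _ ⟩
  diagonalSum c o B                                             ∎
  where open ≡-Reasoning

1+c+o∸c≡1+o : ∀ c o → suc (c + o) ∸ c ≡ suc o
1+c+o∸c≡1+o c o = trans (cong (_∸ c) (sym (+-suc c o))) (m+n∸m≡n c (suc o))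

diagonalSum-rec : ∀ c o B → o ≤ B →
  diagonalSum c (suc (c + o)) (suc B) ≡ diagonalSum c (c + o) (suc B) + diagonalSum c o (suc B)
diagonalSum-rec c o B o≤B = begin
  diagonalSum c (suc (c + o)) (suc B)                          ≡⟨ diagonalSum-suc c (suc (c + o)) B ⟩
  suc (diagonalSum⁺ c (suc (c + o) ∸ c) B)                     ≡⟨ cong (λ x → suc (diagonalSum⁺ c x B)) (1+c+o∸c≡1+o c o) ⟩
  suc (diagonalSum⁺ c (suc o) B)                               ≡⟨ cong suc (diagonalSum⁺-suc c o B) ⟩
  suc (diagonalSum c o B + diagonalSum⁺ c o B)                 ≡⟨ cong suc (+-comm (diagonalSum c o B) _) ⟩
  suc (diagonalSum⁺ c o B) + diagonalSum c o B                 ≡⟨ cong₂ _+_ (cong (λ x → suc (diagonalSum⁺ c x B)) (m+n∸m≡n c o))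
                                                                            (diagonalSum-stable {c} B o≤B) ⟨
  suc (diagonalSum⁺ c (c + o ∸ c) B) + diagonalSum c o (suc B) ≡⟨ cong (_+ diagonalSum c o (suc B)) (diagonalSum-suc c (c + o) B) ⟨
  diagonalSum c (c + o) (suc B) + diagonalSum c o (suc B)      ∎
  where open ≡-Reasoning

K-diagonalSum : ∀ c M {B} → M ≤ B → K (suc c) (suc M) ≡ diagonalSum c M B
K-diagonalSum c = <-rec P step
  where
  P : ℕ → Set
  P M = ∀ {B} → M ≤ B → K (suc c) (suc M) ≡ diagonalSum c M B
  step : ∀ M → (∀ {M′} → M′ < M → P M′) → P M
  step M IH {B} M≤B with M ≤? c
  ... | yes M≤c = trans (K-≤ (s≤s M≤c)) (sym (diagonalSum-≤ B M≤c))
  step M IH M≤B | no M≰c with m≤n⇒∃[o]m+o≡n (≰⇒> M≰c)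
  step _ IH {suc B} (s≤s c+o≤B) | no _ | o , refl = begin
    K (suc c) (suc (suc (c + o)))                           ≡⟨ K-suc (s≤s z≤n) (s≤s (m≤m+n c o)) ⟩
    K (suc c) (suc (c + o)) + K (suc c) (suc (c + o) ∸ c)   ≡⟨ cong (λ x → K (suc c) (suc (c + o)) + K (suc c) x) (1+c+o∸c≡1+o c o) ⟩
    K (suc c) (suc (c + o)) + K (suc c) (suc o)             ≡⟨ cong₂ _+_ (IH ≤-refl (m≤n⇒m≤1+n c+o≤B)) (IH (s≤s (m≤n+m o c)) (m≤n⇒m≤1+n o≤B)) ⟩
    diagonalSum c (c + o) (suc B) + diagonalSum c o (suc B) ≡⟨ diagonalSum-rec c o B o≤B ⟨
    diagonalSum c (suc (c + o)) (suc B)                     ∎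
    where
    open ≡-Reasoning
    o≤B = ≤-trans (m≤n+m o c) c+o≤B

-- Counting Boolean vectors and grids by their number of trues

∑ᵛ : ℕ → (ℕ → ℕ) → ℕ
∑ᵛ m φ = ∑ (allVecs m) (φ ∘ countT)

∑ᵛ-suc : ∀ m φ → ∑ᵛ (suc m) φ ≡ ∑ᵛ m (λ x → φ (suc x) + φ x)
∑ᵛ-suc m φ = trans (∑-concatMap (λ v → (true ∷ v) ∷ (false ∷ v) ∷ []) (allVecs m) (φ ∘ countT))
                   (∑-cong (allVecs m) (λ v → cong (φ (suc (countT v)) +_) (+-identityʳ _)))

∑ᵛ-≡ᵇ : ∀ m k → ∑ᵛ m (λ x → 𝟙 (x ≡ᵇ k)) ≡ m C k
∑ᵛ-≡ᵇ zero    zero    = refl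
∑ᵛ-≡ᵇ zero    (suc k) = refl
∑ᵛ-≡ᵇ (suc m) zero    = trans (∑ᵛ-suc m (λ x → 𝟙 (x ≡ᵇ 0))) (∑ᵛ-≡ᵇ m zero)
∑ᵛ-≡ᵇ (suc m) (suc k) = begin
  ∑ᵛ (suc m) (λ x → 𝟙 (x ≡ᵇ suc k))                     ≡⟨ ∑ᵛ-suc m (λ x → 𝟙 (x ≡ᵇ suc k)) ⟩
  ∑ᵛ m (λ x → 𝟙 (x ≡ᵇ k) + 𝟙 (x ≡ᵇ suc k))             ≡⟨ ∑-+ (allVecs m) _ _ ⟩
  ∑ᵛ m (λ x → 𝟙 (x ≡ᵇ k)) + ∑ᵛ m (λ x → 𝟙 (x ≡ᵇ suc k)) ≡⟨ cong₂ _+_ (∑ᵛ-≡ᵇ m k) (∑ᵛ-≡ᵇ m (suc k)) ⟩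
  m C k + m C suc k                                     ≡⟨ nCk+nC[k+1]≡[n+1]C[k+1] m k ⟩
  suc m C suc k                                         ∎
  where open ≡-Reasoning

∑ᵛ-+ : ∀ a b φ → ∑ (allVecs a) (λ v → ∑ᵛ b (λ x → φ (countT v + x))) ≡ ∑ᵛ (a + b) φ
∑ᵛ-+ zero    b φ = +-identityʳ (∑ᵛ b φ)
∑ᵛ-+ (suc a) b φ = begin
  ∑ (allVecs (suc a)) (λ v → ∑ᵛ b (λ x → φ (countT v + x)))
    ≡⟨ ∑ᵛ-suc a (λ y → ∑ᵛ b (λ x → φ (y + x))) ⟩
  ∑ᵛ a (λ y → ∑ᵛ b (λ x → φ (suc (y + x))) + ∑ᵛ b (λ x → φ (y + x)))
    ≡⟨ ∑-cong (allVecs a) (λ v → sym (∑-+ (allVecs b) _ _)) ⟩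
  ∑ (allVecs a) (λ v → ∑ᵛ b (λ x → ψ (countT v + x)))
    ≡⟨ ∑ᵛ-+ a b ψ ⟩
  ∑ᵛ (a + b) ψ
    ≡⟨ ∑ᵛ-suc (a + b) φ ⟨
  ∑ᵛ (suc a + b) φ ∎
  where
  open ≡-Reasoning
  ψ : ℕ → ℕ
  ψ x = φ (suc x) + φ x

∑-allGrids : ∀ c r φ → ∑ (allGrids c r) (φ ∘ countGrid) ≡ ∑ᵛ (r * c) φ
∑-allGrids c zero    φ = refl
∑-allGrids c (suc r) φ = begin
  ∑ (allGrids c (suc r)) (φ ∘ countGrid)
    ≡⟨ ∑-concatMap (λ v → map (v ∷_) (allGrids c r)) (allVecs c) _ ⟩
  ∑ (allVecs c) (λ v → ∑ (map (v ∷_) (allGrids c r)) (φ ∘ countGrid))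
    ≡⟨ ∑-cong (allVecs c) (λ v → trans (∑-map (v ∷_) (allGrids c r) _)
                                       (∑-allGrids c r (λ x → φ (countT v + x)))) ⟩
  ∑ (allVecs c) (λ v → ∑ᵛ (r * c) (λ x → φ (countT v + x)))
    ≡⟨ ∑ᵛ-+ c (r * c) φ ⟩
  ∑ᵛ (suc r * c) φ ∎
  where open ≡-Reasoning

-- Rows beyond the end of the grid count as empty.
firstRowsEmpty : {c r : ℕ} → ℕ → Vec (Vec Bool c) r → Bool
firstRowsEmpty zero    g       = true
firstRowsEmpty (suc k) []      = true
firstRowsEmpty (suc k) (v ∷ g) = not (anyT v) ∧ firstRowsEmpty k g

∑-allVecs-empty : ∀ c (h : ℕ → ℕ) →
                  ∑ (allVecs c) (λ v → if anyT v then 0 else h (countT v)) ≡ h 0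
∑-allVecs-empty zero    h = +-identityʳ (h 0)
∑-allVecs-empty (suc c) h =
  trans (∑-concatMap (λ v → (true ∷ v) ∷ (false ∷ v) ∷ []) (allVecs c) _)
        (trans (∑-cong (allVecs c) (λ v → +-identityʳ _)) (∑-allVecs-empty c h))

∑-allGrids-firstRowsEmpty : ∀ c r k φ →
  ∑ (allGrids c r) (λ g → if firstRowsEmpty k g then φ (countGrid g) else 0) ≡ ∑ᵛ ((r ∸ k) * c) φ
∑-allGrids-firstRowsEmpty c r       zero    φ = ∑-allGrids c r φ
∑-allGrids-firstRowsEmpty c zero    (suc k) φ = refl
∑-allGrids-firstRowsEmpty c (suc r) (suc k) φ = begin
  ∑ (allGrids c (suc r)) (summand (suc k))
    ≡⟨ ∑-concatMap (λ v → map (v ∷_) (allGrids c r)) (allVecs c) (summand (suc k)) ⟩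
  ∑ (allVecs c) (λ v → ∑ (map (v ∷_) (allGrids c r)) (summand (suc k)))
    ≡⟨ ∑-cong (allVecs c) (λ v → trans (∑-map (v ∷_) (allGrids c r) _) (firstRowEmpty v)) ⟩
  ∑ (allVecs c) (λ v → if anyT v then 0 else rest (countT v))
    ≡⟨ ∑-allVecs-empty c rest ⟩
  rest 0
    ≡⟨ ∑-allGrids-firstRowsEmpty c r k φ ⟩
  ∑ᵛ ((r ∸ k) * c) φ ∎
  where
  open ≡-Reasoning
  summand : ∀ {r} → ℕ → Vec (Vec Bool c) r → ℕ
  summand k g = if firstRowsEmpty k g then φ (countGrid g) else 0
  rest : ℕ → ℕ
  rest x = ∑ (allGrids c r) (λ g → if firstRowsEmpty k g then φ (x + countGrid g) else 0)
  firstRowEmpty : ∀ v → ∑ (allGrids c r) (summand (suc k) ∘ (v ∷_))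
                        ≡ (if anyT v then 0 else rest (countT v))
  firstRowEmpty v with anyT v
  ... | true  = ∑-zero (allGrids c r) (λ g → refl)
  ... | false = refl

-- The condition min C ≥ |C|

-- nothing is the minimum of the empty set, i.e. +∞.
infix 4 _≤ᵐ_
_≤ᵐ_ : ℕ → Maybe ℕ → Set
y ≤ᵐ just m  = y ≤ m
y ≤ᵐ nothing = ⊤

≤ᵐ-minMaybe : ∀ {y} a b → y ≤ᵐ a → y ≤ᵐ b → y ≤ᵐ minMaybe a b
≤ᵐ-minMaybe (just a) (just b) y≤a y≤b = ⊓-glb y≤a y≤b
≤ᵐ-minMaybe (just a) nothing  y≤a _   = y≤a
≤ᵐ-minMaybe nothing  b        _   y≤b = y≤b

≤ᵐ-minMaybeˡ : ∀ {y} a b → y ≤ᵐ minMaybe a b → y ≤ᵐ a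
≤ᵐ-minMaybeˡ (just a) (just b) y≤a⊓b = m≤n⊓o⇒m≤n a b y≤a⊓b
≤ᵐ-minMaybeˡ (just a) nothing  y≤a   = y≤a
≤ᵐ-minMaybeˡ nothing  b        _     = tt

MinCond⇔≤ᵐ : ∀ x {n c} → MinCond (minMaybe x (just n)) c ⇔ c ≤ᵐ minMaybe x (just n)
MinCond⇔≤ᵐ (just a) = mk⇔ id id
MinCond⇔≤ᵐ nothing  = mk⇔ id id

minGrid-≥ : ∀ {c r} (g : Vec (Vec Bool c) r) {start y} → y ≤ start → y ≤ᵐ minGrid start g
minGrid-≥ []      y≤start = tt
minGrid-≥ (v ∷ g) {start} {y} y≤start =
  ≤ᵐ-minMaybe (if anyT v then just start else nothing) _ (first (anyT v))
              (minGrid-≥ g (m≤n⇒m≤1+n y≤start))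
  where
  first : ∀ b → y ≤ᵐ (if b then just start else nothing)
  first true  = y≤start
  first false = tt

-- Row i of the grid has value start + i, so the bound k + start excludes exactly the first k rows.
≤ᵐ-minGrid⇔firstRowsEmpty : ∀ {c r} k start (g : Vec (Vec Bool c) r) →
                            (k + start ≤ᵐ minGrid start g) ⇔ T (firstRowsEmpty k g)
≤ᵐ-minGrid⇔firstRowsEmpty zero    start g       = mk⇔ (λ _ → tt) (λ _ → minGrid-≥ g ≤-refl)
≤ᵐ-minGrid⇔firstRowsEmpty (suc k) start []      = mk⇔ (λ _ → tt) (λ _ → tt)
≤ᵐ-minGrid⇔firstRowsEmpty (suc k) start (v ∷ g) with anyT v
... | true  = mk⇔ (λ k+start<start → ⊥-elim (m+n≮n k start (≤ᵐ-minMaybeˡ (just start) (minGrid (suc start) g) k+start<start)))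
                  (λ ())
... | false = mk⇔ (λ p → to IH (subst (_≤ᵐ minGrid (suc start) g) (sym (+-suc k start)) p))
                  (λ q → subst (_≤ᵐ minGrid (suc start) g) (+-suc k start) (from IH q))
  where IH = ≤ᵐ-minGrid⇔firstRowsEmpty k (suc start) g

anyT≡false⇒countT≡0 : ∀ {m} (v : Vec Bool m) → anyT v ≡ false → countT v ≡ 0
anyT≡false⇒countT≡0 []          _     = refl
anyT≡false⇒countT≡0 (false ∷ v) ¬anyT = anyT≡false⇒countT≡0 v ¬anyT

firstRowsEmpty⇒≤ : ∀ {c r} k (g : Vec (Vec Bool c) r) →
                   T (firstRowsEmpty k g) → k ≤ countGrid g → k ≤ r
firstRowsEmpty⇒≤ zero    g       _     _       = z≤n
firstRowsEmpty⇒≤ (suc k) []      _     ()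
firstRowsEmpty⇒≤ (suc k) (v ∷ g) empty k<count with anyT v in anyT≡
... | true  = ⊥-elim empty
... | false = s≤s (firstRowsEmpty⇒≤ k g empty (<⇒≤ k<count′))
  where
  k<count′ : k < countGrid g
  k<count′ = subst (suc k ≤_) (cong (_+ countGrid g) (anyT≡false⇒countT≡0 v anyT≡)) k<count

module _ {s n : ℕ} (1≤n : 1 ≤ n) (g : Vec (Vec Bool (s ∸ 1)) (n ∸ 1)) where

  inCollection⇔firstRowsEmpty : InCollection (mkSub {s} {n} g true) ⇔ T (firstRowsEmpty (countGrid g) g)
  inCollection⇔firstRowsEmpty = mk⇔
    (λ (_ , minCond) → to minGrid⇔ (≤ᵐ-minMaybeˡ (minGrid 1 g) (just n) (to (MinCond⇔≤ᵐ (minGrid 1 g)) minCond)))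
    (λ empty → refl , from (MinCond⇔≤ᵐ (minGrid 1 g))
                        (≤ᵐ-minMaybe (minGrid 1 g) (just n) (from minGrid⇔ empty) (card≤n empty)))
    where
    minGrid⇔ = ≤ᵐ-minGrid⇔firstRowsEmpty (countGrid g) 1 g
    card≤n : T (firstRowsEmpty (countGrid g) g) → countGrid g + 1 ≤ n
    card≤n empty = subst (countGrid g + 1 ≤_) (m∸n+n≡m 1≤n)
                         (+-monoˡ-≤ 1 (firstRowsEmpty⇒≤ (countGrid g) g empty ≤-refl))

  does-inCollection? : does (inCollection? (mkSub {s} {n} g true)) ≡ firstRowsEmpty (countGrid g) g
  does-inCollection? = det (proof (inCollection? (mkSub {s} {n} g true)))
                           (fromEquivalence (from inCollection⇔firstRowsEmpty) (to inCollection⇔firstRowsEmpty))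

countT≤length : ∀ {m} (v : Vec Bool m) → countT v ≤ m
countT≤length []          = z≤n
countT≤length (true  ∷ v) = s≤s (countT≤length v)
countT≤length (false ∷ v) = m≤n⇒m≤1+n (countT≤length v)

countGrid≤size : ∀ {c r} (g : Vec (Vec Bool c) r) → countGrid g ≤ r * c
countGrid≤size []      = z≤n
countGrid≤size (v ∷ g) = +-mono-≤ (countT≤length v) (countGrid≤size g)

collectionSize≡diagonalSum : ∀ s n → 1 ≤ n →
  collectionSize s n ≡ diagonalSum (s ∸ 1) ((n ∸ 1) * (s ∸ 1)) ((n ∸ 1) * (s ∸ 1))
collectionSize≡diagonalSum s n 1≤n = begin
  collectionSize s n
    ≡⟨ length-filter inCollection? (allSubsetsH s n) ⟩
  ∑ (allSubsetsH s n) (𝟙 ∘ does ∘ inCollection?)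
    ≡⟨ ∑-concatMap (λ g → mkSub {s} {n} g true ∷ mkSub g false ∷ []) (allGrids c r) (𝟙 ∘ does ∘ inCollection?) ⟩
  -- a set without n fails the test top C ≡ true by computation
  ∑ (allGrids c r) (λ g → 𝟙 (does (inCollection? (mkSub {s} {n} g true))) + (0 + 0))
    ≡⟨ ∑-cong (allGrids c r) (λ g → trans (+-identityʳ _) (cong 𝟙 (does-inCollection? {s} {n} 1≤n g))) ⟩
  ∑ (allGrids c r) (λ g → 𝟙 (firstRowsEmpty (countGrid g) g))
    ≡⟨ ∑-cong (allGrids c r) (λ g → ∑≤-select N (countGrid g) (λ k → firstRowsEmpty k g) (countGrid≤size g)) ⟨
  ∑ (allGrids c r) (λ g → ∑≤ N (λ k → summand k g))
    ≡⟨ ∑-∑≤ (allGrids c r) N summand ⟩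
  ∑≤ N (λ k → ∑ (allGrids c r) (summand k))
    ≡⟨ ∑≤-cong N (λ k → trans (∑-allGrids-firstRowsEmpty c r k (λ x → 𝟙 (x ≡ᵇ k))) (∑ᵛ-≡ᵇ ((r ∸ k) * c) k)) ⟩
  ∑≤ N (λ k → ((r ∸ k) * c) C k)
    ≡⟨ ∑≤-cong N (λ k → cong (_C k) (*-distribʳ-∸ c r k)) ⟩
  diagonalSum c N N ∎
  where
  open ≡-Reasoning
  c = s ∸ 1
  r = n ∸ 1
  N = r * c
  summand : ℕ → Vec (Vec Bool c) r → ℕ
  summand k g = if firstRowsEmpty k g then 𝟙 (countGrid g ≡ᵇ k) else 0

-- The hypothesis 2 ≤ s only excludes s = 0: the identity holds for s = 1 as well.
theorem3 : (s n : ℕ) → 2 ≤ s → 1 ≤ n →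
           collectionSize s n ≡ K s ((s ∸ 1) * (n ∸ 1) + 1)
theorem3 zero    n () _
theorem3 (suc c) n _  1≤n = begin
  collectionSize (suc c) n                     ≡⟨ collectionSize≡diagonalSum (suc c) n 1≤n ⟩
  diagonalSum c ((n ∸ 1) * c) ((n ∸ 1) * c)    ≡⟨ K-diagonalSum c ((n ∸ 1) * c) ≤-refl ⟨
  K (suc c) (suc ((n ∸ 1) * c))                ≡⟨ cong (K (suc c)) (+-comm 1 ((n ∸ 1) * c)) ⟩
  K (suc c) ((n ∸ 1) * c + 1)                  ≡⟨ cong (λ x → K (suc c) (x + 1)) (*-comm (n ∸ 1) c) ⟩
  K (suc c) (c * (n ∸ 1) + 1)                  ∎
  where open ≡-Reasoning
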